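{- For $j\in\mathbb{Z}$ let $S_j(z,u)=\sum_{B} z^{|B|}u^{N_j(B)}$, the sum over all naturally embedded ternary trees $B$, where $|B|$ is the number of internal nodes and $N_j(B)$ the number of internal nodes with label $j$. Let $T(z)$ satisfy $T=1+zT^3$, $T(0)=1$, and let $X(z)$ be the formal power series with $X(0)=0$ and $X=z\frac{(1+X+X^2)^3}{(1+X^2)^2}$. Let $\mu=\mu(z,u)$ be the unique formal power series with $\mu(z,1)=0$ satisfying $$\mu=(u-1)\frac{(1+\mu X)(1+\mu X^2)^2(1+\mu X^5)}{(1+X)^2(1-X)^3(1-\mu^2X^5)}.$$ Then for $j\ge 0$, $$S_j(z,u)=T(z)\frac{(1+\mu X^{j+1})(1+\mu X^{j+4})}{(1+\mu X^{j+2})(1+\mu X^{j+3})}.$$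
   Context: A ternary tree is either an external node or an internal node with three ordered subtrees (left, center, right). In the natural embedding the root has label $0$ and the left, center, right children of a node with label $j$ have labels $j-1,j,j+1$. Note $S_j=S_{ -j}$ by symmetry. -}

module Defs where

open import Data.Nat as ℕ using (ℕ; zero; suc; _∸_; _<_)
open import Data.Integer as ℤ using (ℤ; +_; _+_; _-_; _*_; -_)
open import Data.List using (List; []; _∷_; concatMap; map; length; filter)
open import Data.Bool using (Bool; true; false; if_then_else_)
open import Relation.Nullary.Decidable using (⌊_⌋; _×-dec_)
open import Relation.Binary.PropositionalEquality using (_≡_)
open import Data.Product using (Σ; _×_)

data Tree : Set where
  leaf : Tree
  node : Tree → Tree → Tree → Tree

size : Tree → ℕ
size leaf = 0
size (node a b c) = suc (size a ℕ.+ size b ℕ.+ size c)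

labelCount : ℤ → ℤ → Tree → ℕ
labelCount j ℓ leaf = 0
labelCount j ℓ (node a b c) =
  (if ⌊ ℓ ℤ.≟ j ⌋ then 1 else 0)
  ℕ.+ labelCount j (ℓ - + 1) a ℕ.+ labelCount j ℓ b ℕ.+ labelCount j (ℓ + + 1) c

N : ℤ → Tree → ℕ
N j B = labelCount j (+ 0) B

-- all ternary trees of height ≤ d (each exactly once)
treesUpTo : ℕ → List Tree
treesUpTo zero = leaf ∷ []
treesUpTo (suc d) =
  leaf ∷ concatMap (λ a → concatMap (λ b → map (λ c → node a b c) (treesUpTo d))
                                    (treesUpTo d))
                   (treesUpTo d)

-- Formal power series in z and u with integer coefficients:
-- f n k is the coefficient of z^n u^k.

Series : Set
Series = ℕ → ℕ → ℤ

Σ≤ : ℕ → (ℕ → ℤ) → ℤ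
Σ≤ zero f = f 0
Σ≤ (suc n) f = Σ≤ n f + f (suc n)

0S : Series
0S _ _ = + 0

1S : Series
1S zero zero = + 1
1S _ _ = + 0

zS : Series
zS 1 zero = + 1
zS _ _ = + 0

uS : Series
uS zero 1 = + 1
uS _ _ = + 0

_⊕_ : Series → Series → Series
(f ⊕ g) n k = f n k + g n k

_⊖_ : Series → Series → Series
(f ⊖ g) n k = f n k - g n k

_⊗_ : Series → Series → Series
(f ⊗ g) n k = Σ≤ n (λ i → Σ≤ k (λ l → f i l * g (n ∸ i) (k ∸ l)))

infixl 6 _⊕_ _⊖_
infixl 7 _⊗_
infixr 8 _^S_

_^S_ : Series → ℕ → Series
f ^S zero = 1S
f ^S suc m = f ⊗ (f ^S m)

-- Multiplicative inverse of a series f whose z^0-coefficient is 1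
-- (i.e. f(0,u) = 1): 1/f = Σ_m (1 - f)^m, and the coefficient of z^n
-- only receives contributions from m ≤ n.
inv : Series → Series
inv f n k = Σ≤ n (λ m → ((1S ⊖ f) ^S m) n k)

_⊘_ : Series → Series → Series
f ⊘ g = f ⊗ inv g

infixl 7 _⊘_

_≈S_ : Series → Series → Set
f ≈S g = ∀ n k → f n k ≡ g n k

embed : (ℕ → ℤ) → Series
embed f n zero = f n
embed f n (suc _) = + 0

-- A tree with n
-- internal nodes has height ≤ n, so it suffices to look at treesUpTo n.
S : ℤ → Series
S j n k = + length (filter (λ B → (size B ℕ.≟ n) ×-dec (N j B ℕ.≟ k)) (treesUpTo n))

-- "μ(z,1) = 0": every z^n-coefficient of μ is a polynomial in u
-- (coefficients vanish beyond some degree d) whose value at u = 1 is 0.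
VanishesAtU1 : Series → Set
VanishesAtU1 μ = ∀ n → Σ ℕ λ d → (∀ k → d < k → μ n k ≡ + 0) × (Σ≤ d (μ n) ≡ + 0)

module Submission where

-- Cutting a tree at its root gives S_j = 1 + z u^[j = 0] S_(j+1) S_j S_(j-1), and this system has
-- at most one solution, since the z^(n+1)-coefficient of the right-hand side only involves
-- z^(≤n)-coefficients. So it suffices to check that R_j := T N_∣j∣ / D_∣j∣ solves it, where
-- A_k = 1 + μ X^k, N_m = A_(m+1) A_(m+4) and D_m = A_(m+2) A_(m+3). The equations of T and X give
-- T = (1 + X + X²)/(1 + X²) and z T³ = X/(1 + X²). The polynomial identity
-- (1 + X + X²) A_(m+1) A_(m+4) = (1 + X²) A_(m+2) A_(m+3) + X A_m A_(m+5) then shows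
-- R_m - 1 = X A_m A_(m+5) / ((1 + X²) D_m), and for m ≥ 1 the product z R_(m+1) R_m R_(m-1)
-- telescopes to the same expression. For m = 0 the equation of μ supplies the missing factor u:
-- u A_1 A_2² A_5 = A_0 A_3² A_4.

open import Algebra.Bundles using (CommutativeRing; CommutativeSemiring)

module PowerSeries {c ℓ} (R : CommutativeRing c ℓ) where

  open import Data.Nat as ℕ using (ℕ; zero; suc; _∸_; z≤n)
  import Data.Nat.Properties as ℕ
  open import Data.Product using (_,_)
  open import Function using (_∘_)
  open import Relation.Binary.PropositionalEquality as ≡ using (_≡_)
  open import Relation.Binary.Structures using (IsEquivalence)

  open CommutativeRing R
  open import Algebra.Properties.CommutativeSemigroup +-commutativeSemigroup using (interchange)
  open import Relation.Binary.Reasoning.Setoid setoid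

  ∑≤ : ℕ → (ℕ → Carrier) → Carrier
  ∑≤ zero f = f 0
  ∑≤ (suc n) f = ∑≤ n f + f (suc n)

  ∑≤-cong : ∀ n {f g} → (∀ i → i ℕ.≤ n → f i ≈ g i) → ∑≤ n f ≈ ∑≤ n g
  ∑≤-cong zero f≈g = f≈g 0 z≤n
  ∑≤-cong (suc n) f≈g =
    +-cong (∑≤-cong n (λ i i≤n → f≈g i (ℕ.m≤n⇒m≤1+n i≤n))) (f≈g (suc n) ℕ.≤-refl)

  ∑≤-congˡ : ∀ f {m n} → m ≡ n → ∑≤ m f ≈ ∑≤ n f
  ∑≤-congˡ f ≡.refl = refl

  ∑≤-distrib-+ : ∀ n f g → ∑≤ n (λ i → f i + g i) ≈ ∑≤ n f + ∑≤ n g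
  ∑≤-distrib-+ zero f g = refl
  ∑≤-distrib-+ (suc n) f g = trans (+-congʳ (∑≤-distrib-+ n f g)) (interchange _ _ _ _)

  *-distribˡ-∑≤ : ∀ n a f → a * ∑≤ n f ≈ ∑≤ n (λ i → a * f i)
  *-distribˡ-∑≤ zero a f = refl
  *-distribˡ-∑≤ (suc n) a f = trans (distribˡ a _ _) (+-congʳ (*-distribˡ-∑≤ n a f))

  *-distribʳ-∑≤ : ∀ n a f → ∑≤ n f * a ≈ ∑≤ n (λ i → f i * a)
  *-distribʳ-∑≤ zero a f = refl
  *-distribʳ-∑≤ (suc n) a f = trans (distribʳ a _ _) (+-congʳ (*-distribʳ-∑≤ n a f))

  ∑≤-zero : ∀ n f → (∀ i → i ℕ.≤ n → f i ≈ 0#) → ∑≤ n f ≈ 0#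
  ∑≤-zero n f f≈0 = trans (∑≤-cong n f≈0) (zero-sum n)
    where
    zero-sum : ∀ n → ∑≤ n (λ _ → 0#) ≈ 0#
    zero-sum zero = refl
    zero-sum (suc n) = trans (+-identityʳ _) (zero-sum n)

  ∑≤-suc : ∀ n f → ∑≤ (suc n) f ≈ f 0 + ∑≤ n (f ∘ suc)
  ∑≤-suc zero f = refl
  ∑≤-suc (suc n) f = trans (+-congʳ (∑≤-suc n f)) (+-assoc _ _ _)

  ∑≤-reverse : ∀ n f → ∑≤ n f ≈ ∑≤ n (λ i → f (n ∸ i))
  ∑≤-reverse zero f = refl
  ∑≤-reverse (suc n) f = begin
    ∑≤ n f + f (suc n)                ≈⟨ +-congʳ (∑≤-reverse n f) ⟩
    ∑≤ n (λ i → f (n ∸ i)) + f (suc n) ≈⟨ +-comm _ _ ⟩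
    f (suc n) + ∑≤ n (λ i → f (n ∸ i)) ≈⟨ ∑≤-suc n (λ i → f (suc n ∸ i)) ⟨
    ∑≤ (suc n) (λ i → f (suc n ∸ i))   ∎

  ∑≤-triangle : ∀ n (F : ℕ → ℕ → Carrier) →
    ∑≤ n (λ s → ∑≤ s (λ i → F i s)) ≈ ∑≤ n (λ i → ∑≤ (n ∸ i) (λ p → F i (i ℕ.+ p)))
  ∑≤-triangle zero F = refl
  ∑≤-triangle (suc n) F = begin
    ∑≤ n (λ s → ∑≤ s (λ i → F i s)) + (∑≤ n (λ i → F i (suc n)) + F (suc n) (suc n))
      ≈⟨ +-assoc _ _ _ ⟨
    ∑≤ n (λ s → ∑≤ s (λ i → F i s)) + ∑≤ n (λ i → F i (suc n)) + F (suc n) (suc n)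
      ≈⟨ +-cong (+-congʳ (∑≤-triangle n F)) diagonal ⟩
    ∑≤ n (λ i → ∑≤ (n ∸ i) (λ p → F i (i ℕ.+ p))) + ∑≤ n (λ i → F i (suc n)) + row (suc n)
      ≈⟨ +-congʳ (∑≤-distrib-+ n _ _) ⟨
    ∑≤ n (λ i → ∑≤ (n ∸ i) (λ p → F i (i ℕ.+ p)) + F i (suc n)) + row (suc n)
      ≈⟨ +-congʳ (∑≤-cong n extend-row) ⟩
    ∑≤ n row + row (suc n) ∎
    where
    row : ℕ → Carrier
    row i = ∑≤ (suc n ∸ i) (λ p → F i (i ℕ.+ p))

    diagonal : F (suc n) (suc n) ≈ row (suc n)
    diagonal = trans (reflexive (≡.cong (F (suc n)) (≡.sym (ℕ.+-identityʳ (suc n)))))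
                     (∑≤-congˡ (λ p → F (suc n) (suc n ℕ.+ p)) (≡.sym (ℕ.n∸n≡0 n)))

    extend-row : ∀ i → i ℕ.≤ n → ∑≤ (n ∸ i) (λ p → F i (i ℕ.+ p)) + F i (suc n) ≈ row i
    extend-row i i≤n =
      trans (+-congˡ (reflexive (≡.cong (F i) suc-n≡i+suc[n∸i])))
            (∑≤-congˡ (λ p → F i (i ℕ.+ p)) (≡.sym (ℕ.+-∸-assoc 1 i≤n)))
      where
      suc-n≡i+suc[n∸i] : suc n ≡ i ℕ.+ suc (n ∸ i)
      suc-n≡i+suc[n∸i] = ≡.trans (≡.cong suc (≡.sym (ℕ.m+[n∸m]≡n i≤n))) (≡.sym (ℕ.+-suc i (n ∸ i)))

  PS : Set c
  PS = ℕ → Carrier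

  _≋_ : PS → PS → Set ℓ
  f ≋ g = ∀ n → f n ≈ g n

  _⊞_ : PS → PS → PS
  (f ⊞ g) n = f n + g n

  ⊟_ : PS → PS
  (⊟ f) n = - f n

  _⋆_ : PS → PS → PS
  (f ⋆ g) n = ∑≤ n (λ i → f i * g (n ∸ i))

  const : Carrier → PS
  const a zero = a
  const a (suc _) = 0#

  ⋆-cong : ∀ {f f′ g g′} → f ≋ f′ → g ≋ g′ → (f ⋆ g) ≋ (f′ ⋆ g′)
  ⋆-cong f≋f′ g≋g′ n = ∑≤-cong n (λ i _ → *-cong (f≋f′ i) (g≋g′ (n ∸ i)))

  ⋆-comm : ∀ f g → (f ⋆ g) ≋ (g ⋆ f)
  ⋆-comm f g n = trans (∑≤-reverse n _) (∑≤-cong n (λ i i≤n →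
    trans (*-comm _ _) (*-congʳ (reflexive (≡.cong g (ℕ.m∸[m∸n]≡n i≤n))))))

  ⋆-assoc : ∀ f g h → ((f ⋆ g) ⋆ h) ≋ (f ⋆ (g ⋆ h))
  ⋆-assoc f g h n = begin
    ∑≤ n (λ s → ∑≤ s (λ i → f i * g (s ∸ i)) * h (n ∸ s))
      ≈⟨ ∑≤-cong n (λ s _ → *-distribʳ-∑≤ s _ _) ⟩
    ∑≤ n (λ s → ∑≤ s (λ i → f i * g (s ∸ i) * h (n ∸ s)))
      ≈⟨ ∑≤-triangle n (λ i s → f i * g (s ∸ i) * h (n ∸ s)) ⟩
    ∑≤ n (λ i → ∑≤ (n ∸ i) (λ p → f i * g (i ℕ.+ p ∸ i) * h (n ∸ (i ℕ.+ p))))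
      ≈⟨ ∑≤-cong n (λ i _ → ∑≤-cong (n ∸ i) (λ p _ →
           trans (*-assoc _ _ _) (*-congˡ (*-cong (reflexive (≡.cong g (ℕ.m+n∸m≡n i p)))
                                                   (reflexive (≡.cong h (≡.sym (ℕ.∸-+-assoc n i p)))))))) ⟩
    ∑≤ n (λ i → ∑≤ (n ∸ i) (λ p → f i * (g p * h (n ∸ i ∸ p))))
      ≈⟨ ∑≤-cong n (λ i _ → *-distribˡ-∑≤ (n ∸ i) (f i) _) ⟨
    ∑≤ n (λ i → f i * ∑≤ (n ∸ i) (λ p → g p * h (n ∸ i ∸ p))) ∎

  ⋆-distribˡ-⊞ : ∀ f g h → (f ⋆ (g ⊞ h)) ≋ ((f ⋆ g) ⊞ (f ⋆ h))
  ⋆-distribˡ-⊞ f g h n = trans (∑≤-cong n (λ i _ → distribˡ _ _ _)) (∑≤-distrib-+ n _ _)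

  ⋆-distribʳ-⊞ : ∀ f g h → ((g ⊞ h) ⋆ f) ≋ ((g ⋆ f) ⊞ (h ⋆ f))
  ⋆-distribʳ-⊞ f g h n = trans (∑≤-cong n (λ i _ → distribʳ _ _ _)) (∑≤-distrib-+ n _ _)

  ⋆-identityˡ : ∀ f → (const 1# ⋆ f) ≋ f
  ⋆-identityˡ f zero = *-identityˡ _
  ⋆-identityˡ f (suc n) = trans (∑≤-suc n _)
    (trans (+-cong (*-identityˡ _) (∑≤-zero n _ (λ i _ → zeroˡ _))) (+-identityʳ _))

  ⋆-identityʳ : ∀ f → (f ⋆ const 1#) ≋ f
  ⋆-identityʳ f n = trans (⋆-comm f (const 1#) n) (⋆-identityˡ f n)

  const-* : ∀ a b → (const a ⋆ const b) ≋ const (a * b)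
  const-* a b zero = refl
  const-* a b (suc n) = trans (∑≤-suc n _)
    (trans (+-cong (zeroʳ a) (∑≤-zero n _ (λ i _ → zeroˡ _))) (+-identityʳ 0#))

  ≋-isEquivalence : IsEquivalence _≋_
  ≋-isEquivalence = record
    { refl = λ n → refl ; sym = λ f≋g n → sym (f≋g n) ; trans = λ f≋g g≋h n → trans (f≋g n) (g≋h n) }

  powerSeriesRing : CommutativeRing c ℓ
  powerSeriesRing = record
    { Carrier = PS ; _≈_ = _≋_ ; _+_ = _⊞_ ; _*_ = _⋆_ ; -_ = ⊟_ ; 0# = λ _ → 0# ; 1# = const 1#
    ; isCommutativeRing = record
      { isRing = record
        { +-isAbelianGroup = record
          { isGroup = record
            { isMonoid = record
              { isSemigroup = record
                { isMagma = record
                  { isEquivalence = ≋-isEquivalence ; ∙-cong = λ f≋f′ g≋g′ n → +-cong (f≋f′ n) (g≋g′ n) }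
                ; assoc = λ f g h n → +-assoc _ _ _ }
              ; identity = (λ f n → +-identityˡ _) , (λ f n → +-identityʳ _) }
            ; inverse = (λ f n → -‿inverseˡ _) , (λ f n → -‿inverseʳ _)
            ; ⁻¹-cong = λ f≋g n → -‿cong (f≋g n) }
          ; comm = λ f g n → +-comm _ _ }
        ; *-cong = ⋆-cong
        ; *-assoc = ⋆-assoc
        ; *-identity = ⋆-identityˡ , ⋆-identityʳ
        ; distrib = ⋆-distribˡ-⊞ , ⋆-distribʳ-⊞ }
      ; *-comm = ⋆-comm } }

module ListSum {c ℓ} (R : CommutativeSemiring c ℓ) where

  open import Data.List using (List; []; _∷_; _++_; map; concatMap)
  open import Function using (_∘_)
  open import Level using (Level)

  open CommutativeSemiring R
  open import Relation.Binary.Reasoning.Setoid setoid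

  private
    variable
      a b d : Level
      A : Set a
      B : Set b
      C : Set d

  ∑ : (A → Carrier) → List A → Carrier
  ∑ w [] = 0#
  ∑ w (x ∷ xs) = w x + ∑ w xs

  ∑-cong : ∀ {v w : A → Carrier} → (∀ x → v x ≈ w x) → ∀ xs → ∑ v xs ≈ ∑ w xs
  ∑-cong v≈w [] = refl
  ∑-cong v≈w (x ∷ xs) = +-cong (v≈w x) (∑-cong v≈w xs)

  ∑-++ : ∀ (w : A → Carrier) xs ys → ∑ w (xs ++ ys) ≈ ∑ w xs + ∑ w ys
  ∑-++ w [] ys = sym (+-identityˡ _)
  ∑-++ w (x ∷ xs) ys = trans (+-congˡ (∑-++ w xs ys)) (sym (+-assoc _ _ _))

  *-distribˡ-∑ : ∀ k (w : A → Carrier) xs → k * ∑ w xs ≈ ∑ (λ x → k * w x) xs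
  *-distribˡ-∑ k w [] = zeroʳ k
  *-distribˡ-∑ k w (x ∷ xs) = trans (distribˡ k _ _) (+-congˡ (*-distribˡ-∑ k w xs))

  *-distribʳ-∑ : ∀ k (w : A → Carrier) xs → ∑ w xs * k ≈ ∑ (λ x → w x * k) xs
  *-distribʳ-∑ k w [] = zeroˡ k
  *-distribʳ-∑ k w (x ∷ xs) = trans (distribʳ k _ _) (+-congˡ (*-distribʳ-∑ k w xs))

  ∑-map : ∀ (w : B → Carrier) (f : A → B) xs → ∑ w (map f xs) ≈ ∑ (w ∘ f) xs
  ∑-map w f [] = refl
  ∑-map w f (x ∷ xs) = +-congˡ (∑-map w f xs)

  ∑-concatMap : ∀ (w : B → Carrier) (f : A → List B) xs → ∑ w (concatMap f xs) ≈ ∑ (∑ w ∘ f) xs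
  ∑-concatMap w f [] = refl
  ∑-concatMap w f (x ∷ xs) = trans (∑-++ w (f x) (concatMap f xs)) (+-congˡ (∑-concatMap w f xs))

  ∑-*-∑ : ∀ (v : A → Carrier) (w : B → Carrier) xs ys →
          ∑ v xs * ∑ w ys ≈ ∑ (λ x → ∑ (λ y → v x * w y) ys) xs
  ∑-*-∑ v w xs ys = begin
    ∑ v xs * ∑ w ys                         ≈⟨ *-distribʳ-∑ (∑ w ys) v xs ⟩
    ∑ (λ x → v x * ∑ w ys) xs               ≈⟨ ∑-cong (λ x → *-distribˡ-∑ (v x) w ys) xs ⟩
    ∑ (λ x → ∑ (λ y → v x * w y) ys) xs     ∎

  ∑-*-∑-*-∑ : ∀ (u : A → Carrier) (v : B → Carrier) (w : C → Carrier) xs ys zs →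
              ∑ u xs * ∑ v ys * ∑ w zs ≈ ∑ (λ x → ∑ (λ y → ∑ (λ z → u x * v y * w z) zs) ys) xs
  ∑-*-∑-*-∑ u v w xs ys zs = begin
    ∑ u xs * ∑ v ys * ∑ w zs                        ≈⟨ *-congʳ (∑-*-∑ u v xs ys) ⟩
    ∑ (λ x → ∑ (λ y → u x * v y) ys) xs * ∑ w zs    ≈⟨ *-distribʳ-∑ (∑ w zs) _ xs ⟩
    ∑ (λ x → ∑ (λ y → u x * v y) ys * ∑ w zs) xs    ≈⟨ ∑-cong (λ x → ∑-*-∑ (λ y → u x * v y) w ys zs) xs ⟩
    ∑ (λ x → ∑ (λ y → ∑ (λ z → u x * v y * w z) zs) ys) xs ∎

module SeriesRing where

  open import Defs
  import Algebra.Solver.Ring as RingSolver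
  open import Algebra.Solver.Ring.AlmostCommutativeRing
    using (fromCommutativeRing; _-Raw-AlmostCommutative⟶_)
  open import Data.Integer as ℤ using (ℤ; +_; -[1+_])
  import Data.Integer.Properties as ℤ
  open import Data.Maybe using (Maybe; just; nothing)
  open import Data.Nat as ℕ using (ℕ; zero; suc)
  open import Relation.Binary.PropositionalEquality as ≡ using (_≡_)
  open import Relation.Nullary using (yes; no)

  -- Series is ℤ[[u]][[z]]: the z-coefficients are power series in u.
  module ℤ[[u]] = PowerSeries ℤ.+-*-commutativeRing
  module ℤ[[u]][[z]] = PowerSeries ℤ[[u]].powerSeriesRing

  open CommutativeRing ℤ[[u]][[z]].powerSeriesRing
    using (+-isAbelianGroup; setoid)
    renaming (-_ to ⊝_; _*_ to _⋆_; 1# to 𝟙)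
  open ℤ[[u]][[z]] using (⋆-cong; ⋆-assoc; ⋆-comm; ⋆-identityˡ; ⋆-distribˡ-⊞; ⋆-distribʳ-⊞)
  open import Relation.Binary.Reasoning.Setoid setoid

  ∑≤≡Σ≤ : ∀ n f → ℤ[[u]].∑≤ n f ≡ Σ≤ n f
  ∑≤≡Σ≤ zero f = ≡.refl
  ∑≤≡Σ≤ (suc n) f = ≡.cong (ℤ._+ f (suc n)) (∑≤≡Σ≤ n f)

  private
    ∑≤-coeff : ∀ n (h : ℕ → ℕ → ℤ) k → ℤ[[u]][[z]].∑≤ n h k ≡ Σ≤ n (λ i → h i k)
    ∑≤-coeff zero h k = ≡.refl
    ∑≤-coeff (suc n) h k = ≡.cong (ℤ._+ h (suc n) k) (∑≤-coeff n h k)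

    Σ≤-cong : ∀ n {a b : ℕ → ℤ} → (∀ i → a i ≡ b i) → Σ≤ n a ≡ Σ≤ n b
    Σ≤-cong zero a≡b = a≡b 0
    Σ≤-cong (suc n) a≡b = ≡.cong₂ ℤ._+_ (Σ≤-cong n a≡b) (a≡b (suc n))

  ⊗≈⋆ : ∀ f g → (f ⊗ g) ≈S (f ⋆ g)
  ⊗≈⋆ f g n k = ≡.sym (≡.trans (∑≤-coeff n _ k) (Σ≤-cong n (λ i → ∑≤≡Σ≤ k _)))

  1S≈𝟙 : 1S ≈S 𝟙
  1S≈𝟙 zero zero = ≡.refl
  1S≈𝟙 zero (suc k) = ≡.refl
  1S≈𝟙 (suc n) k = ≡.refl

  seriesRing : CommutativeRing _ _
  seriesRing = record
    { Carrier = Series ; _≈_ = _≈S_ ; _+_ = _⊕_ ; _*_ = _⊗_ ; -_ = ⊝_ ; 0# = 0S ; 1# = 1S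
    ; isCommutativeRing = record
      { isRing = record
        { +-isAbelianGroup = +-isAbelianGroup
        ; *-cong = λ {f} {f′} {g} {g′} f≈f′ g≈g′ → begin
            f ⊗ g   ≈⟨ ⊗≈⋆ f g ⟩
            f ⋆ g   ≈⟨ ⋆-cong {f} {f′} {g} {g′} f≈f′ g≈g′ ⟩
            f′ ⋆ g′ ≈⟨ ⊗≈⋆ f′ g′ ⟨
            f′ ⊗ g′ ∎
        ; *-assoc = λ f g h → begin
            (f ⊗ g) ⊗ h ≈⟨ ⊗≈⋆ (f ⊗ g) h ⟩
            (f ⊗ g) ⋆ h ≈⟨ ⋆-cong {g = h} {h} (⊗≈⋆ f g) (λ _ _ → ≡.refl) ⟩
            (f ⋆ g) ⋆ h ≈⟨ ⋆-assoc f g h ⟩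
            f ⋆ (g ⋆ h) ≈⟨ ⋆-cong {f} {f} (λ _ _ → ≡.refl) (⊗≈⋆ g h) ⟨
            f ⋆ (g ⊗ h) ≈⟨ ⊗≈⋆ f (g ⊗ h) ⟨
            f ⊗ (g ⊗ h) ∎
        ; *-identity = identityˡ , λ f → trans (⊗-comm f 1S) (identityˡ f)
        ; distrib = (λ f g h → begin
            f ⊗ (g ⊕ h)       ≈⟨ ⊗≈⋆ f (g ⊕ h) ⟩
            f ⋆ (g ⊕ h)       ≈⟨ ⋆-distribˡ-⊞ f g h ⟩
            f ⋆ g ⊕ f ⋆ h     ≈⟨ ⊕-cong (⊗≈⋆ f g) (⊗≈⋆ f h) ⟨
            f ⊗ g ⊕ f ⊗ h     ∎)
          , (λ f g h → begin
            (g ⊕ h) ⊗ f       ≈⟨ ⊗≈⋆ (g ⊕ h) f ⟩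
            (g ⊕ h) ⋆ f       ≈⟨ ⋆-distribʳ-⊞ f g h ⟩
            g ⋆ f ⊕ h ⋆ f     ≈⟨ ⊕-cong (⊗≈⋆ g f) (⊗≈⋆ h f) ⟨
            g ⊗ f ⊕ h ⊗ f     ∎) }
      ; *-comm = ⊗-comm } }
    where
    open import Data.Product using (_,_)
    open CommutativeRing ℤ[[u]][[z]].powerSeriesRing using (trans) renaming (+-cong to ⊕-cong)
    ⊗-comm : ∀ f g → (f ⊗ g) ≈S (g ⊗ f)
    ⊗-comm f g = begin
      f ⊗ g ≈⟨ ⊗≈⋆ f g ⟩
      f ⋆ g ≈⟨ ⋆-comm f g ⟩
      g ⋆ f ≈⟨ ⊗≈⋆ g f ⟨
      g ⊗ f ∎
    identityˡ : ∀ f → (1S ⊗ f) ≈S f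
    identityˡ f = begin
      1S ⊗ f ≈⟨ ⊗≈⋆ 1S f ⟩
      1S ⋆ f ≈⟨ ⋆-cong {g = f} {f} 1S≈𝟙 (λ _ _ → ≡.refl) ⟩
      𝟙 ⋆ f  ≈⟨ ⋆-identityˡ f ⟩
      f      ∎

  scalar : ℤ → Series
  scalar c = ℤ[[u]][[z]].const (ℤ[[u]].const c)

  -- 0 and 1 go to 0S and 1S themselves, so that solver constants match the statement definitionally.
  ⟦_⟧ℤ : ℤ → Series
  ⟦ + 0 ⟧ℤ = 0S
  ⟦ + 1 ⟧ℤ = 1S
  ⟦ c ⟧ℤ = scalar c

  ⟦⟧ℤ≈scalar : ∀ c → ⟦ c ⟧ℤ ≈S scalar c
  ⟦⟧ℤ≈scalar (+ 0) zero zero = ≡.refl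
  ⟦⟧ℤ≈scalar (+ 0) zero (suc k) = ≡.refl
  ⟦⟧ℤ≈scalar (+ 0) (suc n) k = ≡.refl
  ⟦⟧ℤ≈scalar (+ 1) = 1S≈𝟙
  ⟦⟧ℤ≈scalar (+ suc (suc m)) n k = ≡.refl
  ⟦⟧ℤ≈scalar -[1+ m ] n k = ≡.refl

  scalar-+ : ∀ a b → scalar (a ℤ.+ b) ≈S (scalar a ⊕ scalar b)
  scalar-+ a b zero zero = ≡.refl
  scalar-+ a b zero (suc k) = ≡.refl
  scalar-+ a b (suc n) k = ≡.refl

  scalar-* : ∀ a b → scalar (a ℤ.* b) ≈S (scalar a ⊗ scalar b)
  scalar-* a b = begin
    scalar (a ℤ.* b)   ≈⟨ coefficients ⟨
    ℤ[[u]][[z]].const (ℤ[[u]].const a ℤ[[u]].⋆ ℤ[[u]].const b)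
                       ≈⟨ ℤ[[u]][[z]].const-* (ℤ[[u]].const a) (ℤ[[u]].const b) ⟨
    scalar a ⋆ scalar b ≈⟨ ⊗≈⋆ (scalar a) (scalar b) ⟨
    scalar a ⊗ scalar b ∎
    where
    coefficients : ℤ[[u]][[z]].const (ℤ[[u]].const a ℤ[[u]].⋆ ℤ[[u]].const b) ≈S scalar (a ℤ.* b)
    coefficients zero = ℤ[[u]].const-* a b
    coefficients (suc n) k = ≡.refl

  scalar-neg : ∀ a → scalar (ℤ.- a) ≈S (⊝ scalar a)
  scalar-neg a zero zero = ≡.refl
  scalar-neg a zero (suc k) = ≡.refl
  scalar-neg a (suc n) k = ≡.refl

  private
    module Ring = CommutativeRing seriesRing

    ⟦⟧ℤ-homo₂ : ∀ (_∙_ : ℤ → ℤ → ℤ) (_◦_ : Series → Series → Series) →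
               (∀ {f f′ g g′} → f ≈S f′ → g ≈S g′ → (f ◦ g) ≈S (f′ ◦ g′)) →
               (∀ a b → scalar (a ∙ b) ≈S (scalar a ◦ scalar b)) →
               ∀ a b → ⟦ a ∙ b ⟧ℤ ≈S (⟦ a ⟧ℤ ◦ ⟦ b ⟧ℤ)
    ⟦⟧ℤ-homo₂ _∙_ _◦_ ◦-cong scalar-∙ a b = begin
      ⟦ a ∙ b ⟧ℤ          ≈⟨ ⟦⟧ℤ≈scalar (a ∙ b) ⟩
      scalar (a ∙ b)      ≈⟨ scalar-∙ a b ⟩
      scalar a ◦ scalar b ≈⟨ ◦-cong (⟦⟧ℤ≈scalar a) (⟦⟧ℤ≈scalar b) ⟨
      ⟦ a ⟧ℤ ◦ ⟦ b ⟧ℤ     ∎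

  ⟦⟧ℤ-homomorphism : ℤ.+-*-rawRing -Raw-AlmostCommutative⟶ fromCommutativeRing seriesRing
  ⟦⟧ℤ-homomorphism = record
    { ⟦_⟧ = ⟦_⟧ℤ
    ; +-homo = ⟦⟧ℤ-homo₂ ℤ._+_ _⊕_ Ring.+-cong scalar-+
    ; *-homo = ⟦⟧ℤ-homo₂ ℤ._*_ _⊗_ Ring.*-cong scalar-*
    ; -‿homo = λ a → begin
        ⟦ ℤ.- a ⟧ℤ      ≈⟨ ⟦⟧ℤ≈scalar (ℤ.- a) ⟩
        scalar (ℤ.- a)  ≈⟨ scalar-neg a ⟩
        ⊝ scalar a      ≈⟨ Ring.-‿cong (⟦⟧ℤ≈scalar a) ⟨
        ⊝ ⟦ a ⟧ℤ        ∎
    ; 0-homo = λ _ _ → ≡.refl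
    ; 1-homo = λ _ _ → ≡.refl }

  ⟦⟧ℤ-equal? : ∀ a b → Maybe (⟦ a ⟧ℤ ≈S ⟦ b ⟧ℤ)
  ⟦⟧ℤ-equal? a b with a ℤ.≟ b
  ... | yes ≡.refl = just (λ _ _ → ≡.refl)
  ... | no _ = nothing

  open RingSolver ℤ.+-*-rawRing (fromCommutativeRing seriesRing) ⟦⟧ℤ-homomorphism ⟦⟧ℤ-equal? public
    using (solve; _:=_; _:+_; _:*_; _:-_; _:^_; con)

  ^S-+ : ∀ f p r → (f ^S (p ℕ.+ r)) ≈S (f ^S p ⊗ f ^S r)
  ^S-+ f zero r = Ring.sym (Ring.*-identityˡ (f ^S r))
  ^S-+ f (suc p) r = Ring.trans (Ring.*-congˡ {f} (^S-+ f p r)) (Ring.sym (Ring.*-assoc f (f ^S p) (f ^S r)))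

  ^S-cong : ∀ {f g} → f ≈S g → ∀ m → (f ^S m) ≈S (g ^S m)
  ^S-cong f≈g zero = Ring.refl
  ^S-cong f≈g (suc m) = Ring.*-cong f≈g (^S-cong f≈g m)

module Truncation where

  open import Defs
  open SeriesRing
  open import Data.Integer as ℤ using (ℤ; +_; _+_; _-_; _*_)
  import Data.Integer.Properties as ℤ
  open import Data.Nat as ℕ using (ℕ; zero; suc; _∸_; _≤_; z≤n; s≤s)
  import Data.Nat.Properties as ℕ
  open import Function using (_∘_)
  open import Relation.Binary.PropositionalEquality as ≡ using (_≡_)

  open CommutativeRing seriesRing
    using (setoid; zeroˡ; zeroʳ; distribˡ; +-congʳ; *-congˡ; *-congʳ; *-identityˡ; *-identityʳ)

  Σ≤-cong : ∀ n {f g : ℕ → ℤ} → (∀ i → i ≤ n → f i ≡ g i) → Σ≤ n f ≡ Σ≤ n g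
  Σ≤-cong n {f} {g} f≡g =
    ≡.trans (≡.sym (∑≤≡Σ≤ n f)) (≡.trans (ℤ[[u]].∑≤-cong n f≡g) (∑≤≡Σ≤ n g))

  Σ≤-zero : ∀ n (f : ℕ → ℤ) → (∀ i → i ≤ n → f i ≡ + 0) → Σ≤ n f ≡ + 0
  Σ≤-zero n f f≡0 = ≡.trans (≡.sym (∑≤≡Σ≤ n f)) (ℤ[[u]].∑≤-zero n f f≡0)

  Σ≤-suc : ∀ n (f : ℕ → ℤ) → Σ≤ (suc n) f ≡ f 0 + Σ≤ n (f ∘ suc)
  Σ≤-suc n f = ≡.trans (≡.sym (∑≤≡Σ≤ (suc n) f))
    (≡.trans (ℤ[[u]].∑≤-suc n f) (≡.cong (λ s → f 0 + s) (∑≤≡Σ≤ n (f ∘ suc))))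

  Σ≤-head : ∀ n (f : ℕ → ℤ) → (∀ i → f (suc i) ≡ + 0) → Σ≤ n f ≡ f 0
  Σ≤-head zero f _ = ≡.refl
  Σ≤-head (suc n) f tail≡0 = ≡.trans (≡.cong₂ _+_ (Σ≤-head n f tail≡0) (tail≡0 n)) (ℤ.+-identityʳ (f 0))

  zS⊗-coeff-zero : ∀ g k → (zS ⊗ g) 0 k ≡ + 0
  zS⊗-coeff-zero g k = Σ≤-zero k _ (λ l _ → ℤ.*-zeroˡ (g 0 (k ∸ l)))

  zS⊗-coeff-suc : ∀ g n k → (zS ⊗ g) (suc n) k ≡ g n k
  zS⊗-coeff-suc g n k = begin
    (zS ⊗ g) (suc n) k
      ≡⟨ Σ≤-suc n _ ⟩
    (zS ⊗ (λ i → g (n ∸ i))) 0 k + Σ≤ n (λ i → Σ≤ k (λ l → zS (suc i) l * g (n ∸ i) (k ∸ l)))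
      ≡⟨ ≡.cong₂ _+_ (zS⊗-coeff-zero (λ i → g (n ∸ i)) k) (Σ≤-head n _ (λ i →
           Σ≤-zero k _ (λ l _ → ℤ.*-zeroˡ (g (n ∸ suc i) (k ∸ l))))) ⟩
    + 0 + Σ≤ k (λ l → zS 1 l * g n (k ∸ l))
      ≡⟨ ℤ.+-identityˡ _ ⟩
    Σ≤ k (λ l → zS 1 l * g n (k ∸ l))
      ≡⟨ Σ≤-head k _ (λ l → ℤ.*-zeroˡ (g n (k ∸ suc l))) ⟩
    + 1 * g n k
      ≡⟨ ℤ.*-identityˡ (g n k) ⟩
    g n k ∎
    where open ≡.≡-Reasoning

  uS⊗-coeff-zero : ∀ g n → (uS ⊗ g) n 0 ≡ + 0
  uS⊗-coeff-zero g n = ≡.trans (Σ≤-head n _ (λ i → ℤ.*-zeroˡ (g (n ∸ suc i) 0))) (ℤ.*-zeroˡ (g n 0))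

  uS⊗-coeff-suc : ∀ g n k → (uS ⊗ g) n (suc k) ≡ g n k
  uS⊗-coeff-suc g n k = begin
    (uS ⊗ g) n (suc k)
      ≡⟨ Σ≤-head n _ (λ i → Σ≤-zero (suc k) _ (λ l _ → ℤ.*-zeroˡ (g (n ∸ suc i) (suc k ∸ l)))) ⟩
    Σ≤ (suc k) (λ l → uS 0 l * g n (suc k ∸ l))
      ≡⟨ Σ≤-suc k _ ⟩
    + 0 * g n (suc k) + Σ≤ k (λ l → uS 0 (suc l) * g n (k ∸ l))
      ≡⟨ ≡.cong₂ _+_ (ℤ.*-zeroˡ (g n (suc k))) (Σ≤-head k _ (λ l → ℤ.*-zeroˡ (g n (k ∸ suc l)))) ⟩
    + 0 + + 1 * g n k
      ≡⟨ ≡.trans (ℤ.+-identityˡ _) (ℤ.*-identityˡ (g n k)) ⟩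
    g n k ∎
    where open ≡.≡-Reasoning

  _≈[_]_ : Series → ℕ → Series → Set
  f ≈[ m ] g = ∀ i → i ≤ m → ∀ k → f i k ≡ g i k

  infix 4 _≈[_]_

  ≈⇒≈[] : ∀ {m f g} → f ≈S g → f ≈[ m ] g
  ≈⇒≈[] f≈g i _ k = f≈g i k

  ≈[]-trans : ∀ {m f g h} → f ≈[ m ] g → g ≈[ m ] h → f ≈[ m ] h
  ≈[]-trans f≈g g≈h i i≤m k = ≡.trans (f≈g i i≤m k) (g≈h i i≤m k)

  ≈[]-weaken : ∀ {m m′ f g} → m′ ≤ m → f ≈[ m ] g → f ≈[ m′ ] g
  ≈[]-weaken m′≤m f≈g i i≤m′ k = f≈g i (ℕ.≤-trans i≤m′ m′≤m) k

  ⊗-cong-≈[] : ∀ {m f f′ g g′} → f ≈[ m ] f′ → g ≈[ m ] g′ → f ⊗ g ≈[ m ] f′ ⊗ g′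
  ⊗-cong-≈[] f≈f′ g≈g′ i i≤m k = Σ≤-cong i (λ i′ i′≤i → Σ≤-cong k (λ l _ →
    ≡.cong₂ _*_ (f≈f′ i′ (ℕ.≤-trans i′≤i i≤m) l)
                  (g≈g′ (i ∸ i′) (ℕ.≤-trans (ℕ.m∸n≤m i i′) i≤m) (k ∸ l))))

  ⊗-congˡ-≈[] : ∀ {m} f {g g′} → g ≈[ m ] g′ → f ⊗ g ≈[ m ] f ⊗ g′
  ⊗-congˡ-≈[] f = ⊗-cong-≈[] {f = f} (λ _ _ _ → ≡.refl)

  ⊗-congʳ-≈[] : ∀ {m} g {f f′} → f ≈[ m ] f′ → f ⊗ g ≈[ m ] f′ ⊗ g
  ⊗-congʳ-≈[] g f≈f′ = ⊗-cong-≈[] {g = g} f≈f′ (λ _ _ _ → ≡.refl)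

  ⊗-≈[suc]0 : ∀ {m f g} → f ≈[ 0 ] 0S → g ≈[ m ] 0S → f ⊗ g ≈[ suc m ] 0S
  ⊗-≈[suc]0 {m} {f} {g} f≈0 g≈0 i i≤1+m k = Σ≤-zero i _ (λ i′ _ → Σ≤-zero k _ (λ l _ → term i′ l))
    where
    term : ∀ i′ l → f i′ l * g (i ∸ i′) (k ∸ l) ≡ + 0
    term zero l = ≡.trans (≡.cong (_* g i (k ∸ l)) (f≈0 0 z≤n l)) (ℤ.*-zeroˡ (g i (k ∸ l)))
    term (suc i′) l =
      ≡.trans (≡.cong (f (suc i′) l *_) (g≈0 (i ∸ suc i′) i∸1+i′≤m (k ∸ l))) (ℤ.*-zeroʳ (f (suc i′) l))
      where
      i∸1+i′≤m : i ∸ suc i′ ≤ m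
      i∸1+i′≤m = ℕ.≤-trans (ℕ.∸-monoʳ-≤ i (s≤s (z≤n {i′}))) (ℕ.∸-monoˡ-≤ 1 i≤1+m)

  1S⊕-≈[]1 : ∀ {f} → f ≈[ 0 ] 0S → 1S ⊕ f ≈[ 0 ] 1S
  1S⊕-≈[]1 {f} f≈0 i i≤0 k = ≡.trans (≡.cong (λ x → 1S i k + x) (f≈0 i i≤0 k)) (ℤ.+-identityʳ (1S i k))

  1S⊖-≈[]1 : ∀ {f} → f ≈[ 0 ] 0S → 1S ⊖ f ≈[ 0 ] 1S
  1S⊖-≈[]1 {f} f≈0 i i≤0 k = ≡.trans (≡.cong (λ x → 1S i k - x) (f≈0 i i≤0 k)) (ℤ.+-identityʳ (1S i k))

  ⊗-≈[]1 : ∀ {f g} → f ≈[ 0 ] 1S → g ≈[ 0 ] 1S → f ⊗ g ≈[ 0 ] 1S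
  ⊗-≈[]1 f≈1 g≈1 = ≈[]-trans (⊗-cong-≈[] f≈1 g≈1) (≈⇒≈[] (*-identityˡ 1S))

  ^S-≈[]1 : ∀ {f} → f ≈[ 0 ] 1S → ∀ m → f ^S m ≈[ 0 ] 1S
  ^S-≈[]1 f≈1 zero = λ _ _ _ → ≡.refl
  ^S-≈[]1 f≈1 (suc m) = ⊗-≈[]1 f≈1 (^S-≈[]1 f≈1 m)

  ⊗-≈[]0ʳ : ∀ {m} f {g} → g ≈[ m ] 0S → f ⊗ g ≈[ m ] 0S
  ⊗-≈[]0ʳ f g≈0 = ≈[]-trans (⊗-congˡ-≈[] f g≈0) (≈⇒≈[] (zeroʳ f))

  -- The coefficient of z^(n+1) of d is that of d K at z^n, which only involves lower coefficients of d.
  ≈zS⊗⊗⇒≈0 : ∀ d K → d ≈S (zS ⊗ (d ⊗ K)) → d ≈S 0S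
  ≈zS⊗⊗⇒≈0 d K d≈zdK n k = d≈[]0 n n ℕ.≤-refl k
    where
    d≈[]0 : ∀ m → d ≈[ m ] 0S
    d≈[]0 m zero _ k = ≡.trans (d≈zdK 0 k) (zS⊗-coeff-zero (d ⊗ K) k)
    d≈[]0 (suc m) (suc i) (s≤s i≤m) k =
      ≡.trans (d≈zdK (suc i) k) (≡.trans (zS⊗-coeff-suc (d ⊗ K) i k)
        (≈[]-trans (⊗-congʳ-≈[] K (d≈[]0 m)) (≈⇒≈[] (zeroˡ K)) i i≤m k))

  module _ (f : Series) (f≈1 : f ≈[ 0 ] 1S) where

    private
      g : Series
      g = 1S ⊖ f

      g≈[]0 : g ≈[ 0 ] 0S
      g≈[]0 zero _ k = ≡.trans (≡.cong (λ x → 1S 0 k - x) (f≈1 0 z≤n k)) (ℤ.+-inverseʳ (1S 0 k))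

      g^suc≈[]0 : ∀ m → g ^S suc m ≈[ m ] 0S
      g^suc≈[]0 zero = ≈[]-trans (⊗-congʳ-≈[] 1S g≈[]0) (≈⇒≈[] (zeroˡ 1S))
      g^suc≈[]0 (suc m) = ⊗-≈[suc]0 g≈[]0 (g^suc≈[]0 m)

      geometric : ℕ → Series
      geometric N n k = Σ≤ N (λ m → (g ^S m) n k)

      geometric-stable : ∀ n d k → geometric (n ℕ.+ d) n k ≡ geometric n n k
      geometric-stable n zero k = ≡.cong (λ N → geometric N n k) (ℕ.+-identityʳ n)
      geometric-stable n (suc d) k = begin
        geometric (n ℕ.+ suc d) n k
          ≡⟨ ≡.cong (λ N → geometric N n k) (ℕ.+-suc n d) ⟩
        geometric (n ℕ.+ d) n k + (g ^S suc (n ℕ.+ d)) n k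
          ≡⟨ ≡.cong₂ _+_ (geometric-stable n d k) (g^suc≈[]0 (n ℕ.+ d) n (ℕ.m≤m+n n d) k) ⟩
        geometric n n k + + 0
          ≡⟨ ℤ.+-identityʳ _ ⟩
        geometric n n k ∎
        where open ≡.≡-Reasoning

      inv≈[]geometric : ∀ N → inv f ≈[ N ] geometric N
      inv≈[]geometric N i i≤N k =
        ≡.trans (≡.sym (geometric-stable i (N ∸ i) k)) (≡.cong (λ M → geometric M i k) (ℕ.m+[n∸m]≡n i≤N))

      ⊗-geometric : ∀ N → (f ⊗ geometric N) ≈S (1S ⊖ g ^S suc N)
      ⊗-geometric zero =
        solve 1 (λ f → f :* con (+ 1) := con (+ 1) :- (con (+ 1) :- f) :* con (+ 1)) (λ _ _ → ≡.refl) f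
      ⊗-geometric (suc N) = begin
        f ⊗ (geometric N ⊕ G)   ≈⟨ distribˡ f (geometric N) G ⟩
        f ⊗ geometric N ⊕ f ⊗ G ≈⟨ +-congʳ (⊗-geometric N) ⟩
        (1S ⊖ G) ⊕ f ⊗ G        ≈⟨ telescope f G ⟩
        1S ⊖ g ⊗ G              ∎
        where
        open import Relation.Binary.Reasoning.Setoid setoid
        G : Series
        G = g ^S suc N
        telescope : ∀ f G → ((1S ⊖ G) ⊕ f ⊗ G) ≈S (1S ⊖ (1S ⊖ f) ⊗ G)
        telescope = solve 2 (λ f G → (con (+ 1) :- G) :+ f :* G := con (+ 1) :- (con (+ 1) :- f) :* G)
                            (λ _ _ → ≡.refl)

    ⊗-inv : (f ⊗ inv f) ≈S 1S
    ⊗-inv n k = begin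
      (f ⊗ inv f) n k           ≡⟨ ⊗-congˡ-≈[] f (inv≈[]geometric n) n ℕ.≤-refl k ⟩
      (f ⊗ geometric n) n k     ≡⟨ ⊗-geometric n n k ⟩
      1S n k - (g ^S suc n) n k ≡⟨ ≡.cong (λ x → 1S n k - x) (g^suc≈[]0 n n ℕ.≤-refl k) ⟩
      1S n k - + 0              ≡⟨ ℤ.+-identityʳ (1S n k) ⟩
      1S n k                    ∎
      where open ≡.≡-Reasoning

  ⊘-elim : ∀ {f g h} → g ≈[ 0 ] 1S → f ≈S (h ⊘ g) → (f ⊗ g) ≈S h
  ⊘-elim {f} {g} {h} g≈1 f≈h⊘g = begin
    f ⊗ g             ≈⟨ *-congʳ {g} f≈h⊘g ⟩
    h ⊗ inv g ⊗ g     ≈⟨ solve 3 (λ h v g → h :* v :* g := h :* (g :* v)) (λ _ _ → ≡.refl) h (inv g) g ⟩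
    h ⊗ (g ⊗ inv g)   ≈⟨ *-congˡ {h} (⊗-inv g g≈1) ⟩
    h ⊗ 1S            ≈⟨ *-identityʳ h ⟩
    h                 ∎
    where open import Relation.Binary.Reasoning.Setoid setoid

module TreeCounting where

  open import Defs
  open SeriesRing
  open Truncation
    using ( zS⊗-coeff-zero; zS⊗-coeff-suc; uS⊗-coeff-zero; uS⊗-coeff-suc
          ; _≈[_]_; ⊗-cong-≈[]; ⊗-congˡ-≈[]; ≈[]-weaken)
  open import Algebra.Bundles using (AbelianGroup)
  open import Data.Bool using (Bool; true; false; if_then_else_; _∧_)
  open import Data.Integer as ℤ using (ℤ; +_; -_; _+_; _-_)
  import Data.Integer.Properties as ℤ
  open import Data.List using (List; []; _∷_; map; concatMap; length; filter)
  open import Data.Nat as ℕ using (ℕ; zero; suc; _≡ᵇ_; s≤s)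
  import Data.Nat.Properties as ℕ
  open import Function using (_∘_)
  open import Relation.Binary.PropositionalEquality as ≡ using (_≡_)
  open import Relation.Nullary using (yes; no)
  open import Relation.Nullary.Decidable using (⌊_⌋; _×-dec_; isYes≗does; dec-true; dec-false)
  open import Algebra.Properties.CommutativeSemigroup ℤ.+-commutativeSemigroup using (xy∙z≈xz∙y)
  open import Algebra.Properties.Group (AbelianGroup.group ℤ.+-0-abelianGroup) using (∙-cancelʳ)

  open CommutativeRing seriesRing
    using (commutativeSemiring; setoid; refl; sym; trans; +-cong; *-cong; *-congˡ; *-congʳ; *-assoc; *-identityˡ)
  open ListSum commutativeSemiring
  open import Relation.Binary.Reasoning.Setoid setoid

  monomial : ℕ → ℕ → Series
  monomial p q = zS ^S p ⊗ uS ^S q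

  monomial-coeff : ∀ p q n k → monomial p q n k ≡ + (if (p ≡ᵇ n) ∧ (q ≡ᵇ k) then 1 else 0)
  monomial-coeff zero q n k = ≡.trans (*-identityˡ (uS ^S q) n k) (uS^-coeff q n k)
    where
    uS^-coeff : ∀ q n k → (uS ^S q) n k ≡ + (if (0 ≡ᵇ n) ∧ (q ≡ᵇ k) then 1 else 0)
    uS^-coeff zero zero zero = ≡.refl
    uS^-coeff zero zero (suc k) = ≡.refl
    uS^-coeff zero (suc n) k = ≡.refl
    uS^-coeff (suc q) zero zero = uS⊗-coeff-zero (uS ^S q) 0
    uS^-coeff (suc q) (suc n) zero = uS⊗-coeff-zero (uS ^S q) (suc n)
    uS^-coeff (suc q) zero (suc k) = ≡.trans (uS⊗-coeff-suc (uS ^S q) 0 k) (uS^-coeff q 0 k)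
    uS^-coeff (suc q) (suc n) (suc k) = ≡.trans (uS⊗-coeff-suc (uS ^S q) (suc n) k) (uS^-coeff q (suc n) k)
  monomial-coeff (suc p) q n k = ≡.trans (*-assoc zS (zS ^S p) (uS ^S q) n k) (shifted n)
    where
    shifted : ∀ n → (zS ⊗ monomial p q) n k ≡ + (if (suc p ≡ᵇ n) ∧ (q ≡ᵇ k) then 1 else 0)
    shifted zero = zS⊗-coeff-zero (monomial p q) k
    shifted (suc n) = ≡.trans (zS⊗-coeff-suc (monomial p q) n k) (monomial-coeff p q n k)

  monomial-+ : ∀ p q r s → monomial (p ℕ.+ r) (q ℕ.+ s) ≈S (monomial p q ⊗ monomial r s)
  monomial-+ p q r s = trans (*-cong (^S-+ zS p r) (^S-+ uS q s))
    (solve 4 (λ a b c d → (a :* b) :* (c :* d) := (a :* c) :* (b :* d)) (λ _ _ → ≡.refl)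
      (zS ^S p) (zS ^S r) (uS ^S q) (uS ^S s))

  gf : (Tree → ℕ) → List Tree → Series
  gf h = ∑ (λ B → monomial (size B) (h B))

  length-filter≡gf : ∀ h L n k →
    + length (filter (λ B → (size B ℕ.≟ n) ×-dec (h B ℕ.≟ k)) L) ≡ gf h L n k
  length-filter≡gf h [] n k = ≡.refl
  length-filter≡gf h (B ∷ L) n k =
    ≡.trans first-tree (≡.cong₂ _+_ (≡.sym (monomial-coeff (size B) (h B) n k)) (length-filter≡gf h L n k))
    where
    first-tree : + length (filter (λ B → (size B ℕ.≟ n) ×-dec (h B ℕ.≟ k)) (B ∷ L))
               ≡ + (if (size B ≡ᵇ n) ∧ (h B ≡ᵇ k) then 1 else 0)
                 + + length (filter (λ B → (size B ℕ.≟ n) ×-dec (h B ℕ.≟ k)) L)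
    first-tree with (size B ≡ᵇ n) ∧ (h B ≡ᵇ k)
    ... | true = ≡.refl
    ... | false = ≡.refl

  labelCount-shift : ∀ j ℓ c B → labelCount (j + c) (ℓ + c) B ≡ labelCount j ℓ B
  labelCount-shift j ℓ c leaf = ≡.refl
  labelCount-shift j ℓ c (node l m r) =
    ≡.cong₂ ℕ._+_ (≡.cong₂ ℕ._+_ (≡.cong₂ ℕ._+_ root-label (child (- + 1) l)) (labelCount-shift j ℓ c m))
                  (child (+ 1) r)
    where
    root-label : (if ⌊ ℓ + c ℤ.≟ j + c ⌋ then 1 else 0) ≡ (if ⌊ ℓ ℤ.≟ j ⌋ then 1 else 0)
    root-label with ℓ ℤ.≟ j
    ... | yes ≡.refl = ≡.cong (λ b → if b then 1 else 0)
      (≡.trans (isYes≗does _) (dec-true (ℓ + c ℤ.≟ ℓ + c) ≡.refl))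
    ... | no ℓ≢j = ≡.cong (λ b → if b then 1 else 0)
      (≡.trans (isYes≗does _) (dec-false (ℓ + c ℤ.≟ j + c) (ℓ≢j ∘ ∙-cancelʳ c ℓ j)))
    child : ∀ d B → labelCount (j + c) (ℓ + c + d) B ≡ labelCount j (ℓ + d) B
    child d B =
      ≡.trans (≡.cong (λ x → labelCount (j + c) x B) (xy∙z≈xz∙y ℓ c d)) (labelCount-shift j (ℓ + d) c B)

  gf-cong : ∀ {h h′} → (∀ B → h B ≡ h′ B) → ∀ L → gf h L ≈S gf h′ L
  gf-cong h≡h′ = ∑-cong (λ B → λ n k → ≡.cong (λ q → monomial (size B) q n k) (h≡h′ B))

  S≤ : ℤ → ℕ → Series
  S≤ j d = gf (N j) (treesUpTo d)

  S≡S≤ : ∀ j n k → S j n k ≡ S≤ j n n k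
  S≡S≤ j n k = length-filter≡gf (N j) (treesUpTo n) n k

  rootWeight : ℤ → Series
  rootWeight j = if ⌊ + 0 ℤ.≟ j ⌋ then uS else 1S

  leafOrNode : Series → Series → Series → Series → Series
  leafOrNode U l c r = 1S ⊕ zS ⊗ (U ⊗ ((l ⊗ c) ⊗ r))

  S≤-zero : ∀ j → S≤ j 0 ≈S 1S
  S≤-zero j n k = ≡.trans (ℤ.+-identityʳ _) (*-identityˡ 1S n k)

  S≤-suc : ∀ j d → S≤ j (suc d) ≈S leafOrNode (rootWeight j) (S≤ (j + + 1) d) (S≤ j d) (S≤ (j - + 1) d)
  S≤-suc j d = +-cong (*-identityˡ 1S) (begin
    ∑ w (concatMap (λ a → concatMap (λ b → map (node a b) T) T) T)
      ≈⟨ ∑-concatMap w _ T ⟩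
    ∑ (λ a → ∑ w (concatMap (λ b → map (node a b) T) T)) T
      ≈⟨ ∑-cong (λ a → trans (∑-concatMap w _ T) (∑-cong (λ b → ∑-map w (node a b) T) T)) T ⟩
    ∑ (λ a → ∑ (λ b → ∑ (λ c → w (node a b c)) T) T) T
      ≈⟨ ∑-cong (λ a → ∑-cong (λ b → ∑-cong (node-weight a b) T) T) T ⟩
    ∑ (λ a → ∑ (λ b → ∑ (λ c → (monomial 1 δ ⊗ wl a) ⊗ w b ⊗ wr c) T) T) T
      ≈⟨ ∑-*-∑-*-∑ (λ a → monomial 1 δ ⊗ wl a) w wr T T T ⟨
    ∑ (λ a → monomial 1 δ ⊗ wl a) T ⊗ S≤ j d ⊗ ∑ wr T
      ≈⟨ *-congʳ {∑ wr T} (*-congʳ {S≤ j d} (*-distribˡ-∑ (monomial 1 δ) wl T)) ⟨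
    monomial 1 δ ⊗ ∑ wl T ⊗ S≤ j d ⊗ ∑ wr T
      ≈⟨ *-cong (*-cong (*-cong (monomial-root δ-root) (gf-cong left-label T)) (refl {S≤ j d}))
                (gf-cong right-label T) ⟩
    (zS ⊗ rootWeight j) ⊗ S≤ (j + + 1) d ⊗ S≤ j d ⊗ S≤ (j - + 1) d
      ≈⟨ solve 5 (λ z U l c r → ((z :* U) :* l) :* c :* r := z :* (U :* ((l :* c) :* r))) (λ _ _ → ≡.refl)
           zS (rootWeight j) (S≤ (j + + 1) d) (S≤ j d) (S≤ (j - + 1) d) ⟩
    zS ⊗ (rootWeight j ⊗ ((S≤ (j + + 1) d ⊗ S≤ j d) ⊗ S≤ (j - + 1) d)) ∎)
    where
    T : List Tree
    T = treesUpTo d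
    δ-root : Bool
    δ-root = ⌊ + 0 ℤ.≟ j ⌋
    δ : ℕ
    δ = if δ-root then 1 else 0
    w wl wr : Tree → Series
    w B = monomial (size B) (N j B)
    wl B = monomial (size B) (labelCount j (- + 1) B)
    wr B = monomial (size B) (labelCount j (+ 1) B)

    node-weight : ∀ a b c → w (node a b c) ≈S ((monomial 1 δ ⊗ wl a) ⊗ w b ⊗ wr c)
    node-weight a b c = begin
      w (node a b c)
        ≈⟨ monomial-+ (suc (size a ℕ.+ size b)) (δ ℕ.+ labelCount j (- + 1) a ℕ.+ N j b) (size c) _ ⟩
      monomial (suc (size a ℕ.+ size b)) (δ ℕ.+ labelCount j (- + 1) a ℕ.+ N j b) ⊗ wr c
        ≈⟨ *-congʳ {wr c} (trans (monomial-+ (suc (size a)) (δ ℕ.+ labelCount j (- + 1) a) (size b) _)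
                           (*-congʳ {w b} (monomial-+ 1 δ (size a) _))) ⟩
      (monomial 1 δ ⊗ wl a) ⊗ w b ⊗ wr c ∎

    monomial-root : ∀ b → monomial 1 (if b then 1 else 0) ≈S (zS ⊗ (if b then uS else 1S))
    monomial-root true = solve 2 (λ z u → (z :* con (+ 1)) :* (u :* con (+ 1)) := z :* u) (λ _ _ → ≡.refl) zS uS
    monomial-root false = solve 1 (λ z → (z :* con (+ 1)) :* con (+ 1) := z :* con (+ 1)) (λ _ _ → ≡.refl) zS

    left-label : ∀ B → labelCount j (- + 1) B ≡ N (j + + 1) B
    left-label B = ≡.sym (labelCount-shift j (- + 1) (+ 1) B)

    right-label : ∀ B → labelCount j (+ 1) B ≡ N (j - + 1) B
    right-label B = ≡.trans (≡.cong (λ i → labelCount i (+ 1) B) (≡.sym j-1+1≡j))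
                            (labelCount-shift (j - + 1) (+ 0) (+ 1) B)
      where
      j-1+1≡j : j - + 1 + + 1 ≡ j
      j-1+1≡j = ≡.trans (ℤ.+-assoc j (- + 1) (+ 1)) (ℤ.+-identityʳ j)

  leafOrNode-coeff-zero : ∀ U l c r k → leafOrNode U l c r 0 k ≡ 1S 0 k
  leafOrNode-coeff-zero U l c r k =
    ≡.trans (≡.cong (λ x → 1S 0 k + x) (zS⊗-coeff-zero (U ⊗ ((l ⊗ c) ⊗ r)) k)) (ℤ.+-identityʳ (1S 0 k))

  leafOrNode-coeff-suc : ∀ U l c r n k → leafOrNode U l c r (suc n) k ≡ (U ⊗ ((l ⊗ c) ⊗ r)) n k
  leafOrNode-coeff-suc U l c r n k = ≡.trans (ℤ.+-identityˡ _) (zS⊗-coeff-suc (U ⊗ ((l ⊗ c) ⊗ r)) n k)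

  -- The recurrence determines its solution: the coefficient of z^(n+1) of leafOrNode U l c r
  -- only involves those of l, c, r up to z^n, so S≤ _ d agrees with any solution up to z^d.
  S≈solution : (R : ℤ → Series) → (∀ j → R j ≈S leafOrNode (rootWeight j) (R (j + + 1)) (R j) (R (j - + 1))) →
               ∀ j → S j ≈S R j
  S≈solution R R-rec j n k = ≡.trans (S≡S≤ j n k) (S≤≈[]R n j n ℕ.≤-refl k)
    where
    children : (ℤ → Series) → ℤ → Series
    children F j = rootWeight j ⊗ ((F (j + + 1) ⊗ F j) ⊗ F (j - + 1))

    R-coeff-zero : ∀ j k → R j 0 k ≡ 1S 0 k
    R-coeff-zero j k = ≡.trans (R-rec j 0 k)
      (leafOrNode-coeff-zero (rootWeight j) (R (j + + 1)) (R j) (R (j - + 1)) k)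

    R-coeff-suc : ∀ j n k → R j (suc n) k ≡ children R j n k
    R-coeff-suc j n k = ≡.trans (R-rec j (suc n) k)
      (leafOrNode-coeff-suc (rootWeight j) (R (j + + 1)) (R j) (R (j - + 1)) n k)

    S≤-coeff-suc : ∀ d j n k → S≤ j (suc d) (suc n) k ≡ children (λ j → S≤ j d) j n k
    S≤-coeff-suc d j n k = ≡.trans (S≤-suc j d (suc n) k)
      (leafOrNode-coeff-suc (rootWeight j) (S≤ (j + + 1) d) (S≤ j d) (S≤ (j - + 1) d) n k)

    S≤≈[]R : ∀ d j → S≤ j d ≈[ d ] R j
    S≤≈[]R zero j zero _ k = ≡.trans (S≤-zero j 0 k) (≡.sym (R-coeff-zero j k))
    S≤≈[]R (suc d) j zero _ k = ≡.trans (S≤-suc j d 0 k)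
      (≡.trans (leafOrNode-coeff-zero (rootWeight j) (S≤ (j + + 1) d) (S≤ j d) (S≤ (j - + 1) d) k)
               (≡.sym (R-coeff-zero j k)))
    S≤≈[]R (suc d) j (suc i) (s≤s i≤d) k = ≡.trans (S≤-coeff-suc d j i k)
      (≡.trans (⊗-congˡ-≈[] (rootWeight j) (⊗-cong-≈[] (⊗-cong-≈[] (IH (j + + 1)) (IH j)) (IH (j - + 1)))
                             i ℕ.≤-refl k)
               (≡.sym (R-coeff-suc j i k)))
      where
      IH : ∀ j′ → S≤ j′ d ≈[ i ] R j′
      IH j′ = ≈[]-weaken i≤d (S≤≈[]R d j′)

open import Defs
open import Data.Nat using (ℕ; zero; suc; _+_)
open import Data.Integer using (ℤ; +_)
open import Relation.Binary.PropositionalEquality using (_≡_)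

module ClosedForm
  (T X : ℕ → ℤ) (μ : Series)
  (X0≡0 : X 0 ≡ + 0)
  (T-eq : embed T ≈S (1S ⊕ zS ⊗ embed T ^S 3))
  (X-eq : embed X ≈S (zS ⊗ (1S ⊕ embed X ⊕ embed X ^S 2) ^S 3 ⊘ (1S ⊕ embed X ^S 2) ^S 2))
  (μ-eq : μ ≈S ((uS ⊖ 1S)
           ⊗ ((1S ⊕ μ ⊗ embed X) ⊗ (1S ⊕ μ ⊗ embed X ^S 2) ^S 2 ⊗ (1S ⊕ μ ⊗ embed X ^S 5))
           ⊘ ((1S ⊕ embed X) ^S 2 ⊗ (1S ⊖ embed X) ^S 3 ⊗ (1S ⊖ μ ^S 2 ⊗ embed X ^S 5))))
  where

  open SeriesRing
  open Truncation
  open TreeCounting using (leafOrNode; rootWeight)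
  import Data.Integer as ℤ
  import Data.Integer.Properties as ℤ
  open import Data.Nat as ℕ using (zero; suc)
  import Data.Nat.Properties as ℕ
  import Relation.Binary.PropositionalEquality as ≡

  open CommutativeRing seriesRing
    using ( setoid; refl; sym; trans; reflexive; +-cong; +-congˡ; +-congʳ; -‿cong
          ; *-cong; *-congˡ; *-congʳ; *-identityˡ; *-identityʳ; zeroˡ)
  open import Relation.Binary.Reasoning.Setoid setoid
  open import Algebra.Solver.CommutativeMonoid (CommutativeRing.*-commutativeMonoid seriesRing)
    using () renaming (solve to rearrange; _⊜_ to _≡×_; _⊕_ to infixl 7 _·_; id to ε)

  t x W Q V : Series
  t = embed T
  x = embed X
  W = 1S ⊕ x ^S 2
  Q = 1S ⊕ x ⊕ x ^S 2
  V = inv W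

  x≈[]0 : x ≈[ 0 ] 0S
  x≈[]0 zero _ zero = X0≡0
  x≈[]0 zero _ (suc k) = ≡.refl

  x^suc≈[]0 : ∀ e → x ^S suc e ≈[ 0 ] 0S
  x^suc≈[]0 e = ≈[]-trans (⊗-congʳ-≈[] (x ^S e) x≈[]0) (≈⇒≈[] (zeroˡ (x ^S e)))

  W≈[]1 : W ≈[ 0 ] 1S
  W≈[]1 = 1S⊕-≈[]1 (x^suc≈[]0 1)

  W⊗V : (W ⊗ V) ≈S 1S
  W⊗V = ⊗-inv W W≈[]1

  x⊗W²≈zS⊗Q³ : (x ⊗ W ^S 2) ≈S (zS ⊗ Q ^S 3)
  x⊗W²≈zS⊗Q³ = ⊘-elim (^S-≈[]1 W≈[]1 2) X-eq

  zS⊗[Q⊗V]³≈x⊗V : (zS ⊗ (Q ⊗ V) ^S 3) ≈S (x ⊗ V)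
  zS⊗[Q⊗V]³≈x⊗V = begin
    zS ⊗ (Q ⊗ V) ^S 3          ≈⟨ solve 3 (λ z q v → z :* (q :* v) :^ 3 := z :* q :^ 3 :* v :^ 3)
                                          (λ _ _ → ≡.refl) zS Q V ⟩
    zS ⊗ Q ^S 3 ⊗ V ^S 3       ≈⟨ *-congʳ {V ^S 3} x⊗W²≈zS⊗Q³ ⟨
    x ⊗ W ^S 2 ⊗ V ^S 3        ≈⟨ solve 3 (λ x w v → x :* w :^ 2 :* v :^ 3 := x :* v :* ((w :* v) :* (w :* v)))
                                        (λ _ _ → ≡.refl) x W V ⟩
    x ⊗ V ⊗ ((W ⊗ V) ⊗ (W ⊗ V)) ≈⟨ *-congˡ {x ⊗ V} (*-cong W⊗V W⊗V) ⟩
    x ⊗ V ⊗ (1S ⊗ 1S)          ≈⟨ solve 2 (λ x v → x :* v :* (con (+ 1) :* con (+ 1)) := x :* v)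
                                          (λ _ _ → ≡.refl) x V ⟩
    x ⊗ V                      ∎

  Q⊗V≈1S⊕x⊗V : (Q ⊗ V) ≈S (1S ⊕ x ⊗ V)
  Q⊗V≈1S⊕x⊗V = begin
    Q ⊗ V         ≈⟨ solve 2 (λ x v → (con (+ 1) :+ x :+ x :^ 2) :* v := (con (+ 1) :+ x :^ 2) :* v :+ x :* v)
                            (λ _ _ → ≡.refl) x V ⟩
    W ⊗ V ⊕ x ⊗ V ≈⟨ +-congʳ W⊗V ⟩
    1S ⊕ x ⊗ V    ∎

  t≈Q⊗V : t ≈S (Q ⊗ V)
  t≈Q⊗V n k = ℤ.i-j≡0⇒i≡j (t n k) ((Q ⊗ V) n k) (≈zS⊗⊗⇒≈0 (t ⊖ Q ⊗ V) K difference-eq n k)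
    where
    K : Series
    K = t ⊗ t ⊕ t ⊗ (Q ⊗ V) ⊕ (Q ⊗ V) ⊗ (Q ⊗ V)
    Q⊗V-eq : (Q ⊗ V) ≈S (1S ⊕ zS ⊗ (Q ⊗ V) ^S 3)
    Q⊗V-eq = trans Q⊗V≈1S⊕x⊗V (+-congˡ {1S} (sym zS⊗[Q⊗V]³≈x⊗V))
    difference-eq : (t ⊖ Q ⊗ V) ≈S (zS ⊗ ((t ⊖ Q ⊗ V) ⊗ K))
    difference-eq = begin
      t ⊖ Q ⊗ V ≈⟨ +-cong T-eq (-‿cong Q⊗V-eq) ⟩
      (1S ⊕ zS ⊗ t ^S 3) ⊖ (1S ⊕ zS ⊗ (Q ⊗ V) ^S 3)
        ≈⟨ solve 3 (λ z a b → (con (+ 1) :+ z :* a :^ 3) :- (con (+ 1) :+ z :* b :^ 3)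
                              := z :* ((a :- b) :* (a :* a :+ a :* b :+ b :* b))) (λ _ _ → ≡.refl) zS t (Q ⊗ V) ⟩
      zS ⊗ ((t ⊖ Q ⊗ V) ⊗ K) ∎

  zS⊗t³≈x⊗V : (zS ⊗ t ^S 3) ≈S (x ⊗ V)
  zS⊗t³≈x⊗V = trans (*-congˡ {zS} (^S-cong t≈Q⊗V 3)) zS⊗[Q⊗V]³≈x⊗V

  A : ℕ → Series
  A e = 1S ⊕ μ ⊗ x ^S e

  -- Exponents are written k + m so that closedForm (suc m) unfolds to the same factors A (k + m).
  closedForm : ℕ → Series
  closedForm m = t ⊗ (A (1 + m) ⊗ A (4 + m)) ⊘ (A (2 + m) ⊗ A (3 + m))

  closedForm≡ : ∀ m → closedForm m ≡ t ⊗ (A (m + 1) ⊗ A (m + 4)) ⊘ (A (m + 2) ⊗ A (m + 3))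
  closedForm≡ m =
    ≡.trans (≡.cong₂ (λ a d → t ⊗ (A a ⊗ A d) ⊘ (A (2 + m) ⊗ A (3 + m))) (ℕ.+-comm 1 m) (ℕ.+-comm 4 m))
            (≡.cong₂ (λ b c → t ⊗ (A (m + 1) ⊗ A (m + 4)) ⊘ (A b ⊗ A c)) (ℕ.+-comm 2 m) (ℕ.+-comm 3 m))

  D I E : ℕ → Series
  D m = A (2 + m) ⊗ A (3 + m)
  I m = inv (D m)
  E m = x ⊗ V ⊗ (A m ⊗ A (5 + m)) ⊗ I m

  D⊗I : ∀ m → (D m ⊗ I m) ≈S 1S
  D⊗I m = ⊗-inv (D m) (⊗-≈[]1 (A-suc≈[]1 (1 + m)) (A-suc≈[]1 (2 + m)))
    where
    A-suc≈[]1 : ∀ e → A (suc e) ≈[ 0 ] 1S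
    A-suc≈[]1 e = 1S⊕-≈[]1 (⊗-≈[]0ʳ μ (x^suc≈[]0 e))

  Q⊗A₁A₄≈W⊗D⊕x⊗A₀A₅ : ∀ m → (Q ⊗ (A (1 + m) ⊗ A (4 + m))) ≈S (W ⊗ D m ⊕ x ⊗ (A m ⊗ A (5 + m)))
  Q⊗A₁A₄≈W⊗D⊕x⊗A₀A₅ m = begin
    Q ⊗ (A (1 + m) ⊗ A (4 + m))  ≈⟨ *-congˡ {Q} (*-cong (A≈B 1) (A≈B 4)) ⟩
    Q ⊗ (B 1 ⊗ B 4)              ≈⟨ polynomial-identity x b ⟩
    W ⊗ (B 2 ⊗ B 3) ⊕ x ⊗ (B 0 ⊗ B 5)
      ≈⟨ +-cong (*-congˡ {W} (*-cong (A≈B 2) (A≈B 3))) (*-congˡ {x} (*-cong (A≈B 0) (A≈B 5))) ⟨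
    W ⊗ D m ⊕ x ⊗ (A m ⊗ A (5 + m)) ∎
    where
    b : Series
    b = μ ⊗ x ^S m
    B : ℕ → Series
    B k = 1S ⊕ b ⊗ x ^S k
    A≈B : ∀ k → A (k + m) ≈S B k
    A≈B k = +-congˡ {1S} (trans (*-congˡ {μ} (^S-+ x k m))
      (solve 3 (λ μ a c → μ :* (a :* c) := (μ :* c) :* a) (λ _ _ → ≡.refl) μ (x ^S k) (x ^S m)))
    polynomial-identity : ∀ x b → let B = λ k → 1S ⊕ b ⊗ x ^S k in
      ((1S ⊕ x ⊕ x ^S 2) ⊗ (B 1 ⊗ B 4)) ≈S ((1S ⊕ x ^S 2) ⊗ (B 2 ⊗ B 3) ⊕ x ⊗ (B 0 ⊗ B 5))
    polynomial-identity = solve 2 (λ x b → let B = λ k → con (+ 1) :+ b :* x :^ k in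
      (con (+ 1) :+ x :+ x :^ 2) :* (B 1 :* B 4) := (con (+ 1) :+ x :^ 2) :* (B 2 :* B 3) :+ x :* (B 0 :* B 5))
      (λ _ _ → ≡.refl)

  closedForm≈1S⊕E : ∀ m → closedForm m ≈S (1S ⊕ E m)
  closedForm≈1S⊕E m = begin
    t ⊗ Num ⊗ I m                   ≈⟨ *-congʳ {I m} (*-congʳ {Num} t≈Q⊗V) ⟩
    Q ⊗ V ⊗ Num ⊗ I m               ≈⟨ solve 4 (λ q v n i → q :* v :* n :* i := v :* (q :* n) :* i)
                                               (λ _ _ → ≡.refl) Q V Num (I m) ⟩
    V ⊗ (Q ⊗ Num) ⊗ I m             ≈⟨ *-congʳ {I m} (*-congˡ {V} (Q⊗A₁A₄≈W⊗D⊕x⊗A₀A₅ m)) ⟩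
    V ⊗ (W ⊗ D m ⊕ x ⊗ (A m ⊗ A (5 + m))) ⊗ I m
      ≈⟨ solve 6 (λ v w d x a i → v :* (w :* d :+ x :* a) :* i := (w :* v) :* (d :* i) :+ x :* v :* a :* i)
                  (λ _ _ → ≡.refl) V W (D m) x (A m ⊗ A (5 + m)) (I m) ⟩
    (W ⊗ V) ⊗ (D m ⊗ I m) ⊕ E m   ≈⟨ +-congʳ (trans (*-cong W⊗V (D⊗I m)) (*-identityˡ 1S)) ⟩
    1S ⊕ E m                      ∎
    where
    Num : Series
    Num = A (1 + m) ⊗ A (4 + m)

  -- In z R(m+2) R(m+1) R(m) the numerators A(m+1) … A(m+6) cancel D(m+2) and D(m), leaving E(m+1).
  zS⊗closedForm³≈E : ∀ m →
    (zS ⊗ (1S ⊗ ((closedForm (2 + m) ⊗ closedForm (1 + m)) ⊗ closedForm m))) ≈S E (1 + m)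
  zS⊗closedForm³≈E m = begin
    zS ⊗ (1S ⊗ ((closedForm (2 + m) ⊗ closedForm (1 + m)) ⊗ closedForm m))
      ≈⟨ rearrange 11 (λ z t a₁ a₂ a₃ a₄ a₅ a₆ i₀ i₁ i₂ →
           z · (ε · ((t · (a₃ · a₆) · i₂ · (t · (a₂ · a₅) · i₁)) · (t · (a₁ · a₄) · i₀)))
           ≡× z · (t · (t · (t · ε))) · (a₁ · a₆ · i₁) · ((a₄ · a₅) · i₂) · ((a₂ · a₃) · i₀))
           (λ _ _ → ≡.refl) zS t (A (1 + m)) (A (2 + m)) (A (3 + m)) (A (4 + m)) (A (5 + m)) (A (6 + m))
           (I m) (I (1 + m)) (I (2 + m)) ⟩
    zS ⊗ t ^S 3 ⊗ F ⊗ (D (2 + m) ⊗ I (2 + m)) ⊗ (D m ⊗ I m)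
      ≈⟨ *-cong (*-cong (*-congʳ {F} zS⊗t³≈x⊗V) (D⊗I (2 + m))) (D⊗I m) ⟩
    x ⊗ V ⊗ F ⊗ 1S ⊗ 1S
      ≈⟨ rearrange 5 (λ x v a a′ i → x · v · (a · a′ · i) · ε · ε ≡× x · v · (a · a′) · i)
                     (λ _ _ → ≡.refl) x V (A (1 + m)) (A (6 + m)) (I (1 + m)) ⟩
    E (1 + m) ∎
    where
    F : Series
    F = A (1 + m) ⊗ A (6 + m) ⊗ I (1 + m)

  P Dμ : Series
  P = (1S ⊕ μ ⊗ x) ⊗ (1S ⊕ μ ⊗ x ^S 2) ^S 2 ⊗ (1S ⊕ μ ⊗ x ^S 5)
  Dμ = (1S ⊕ x) ^S 2 ⊗ (1S ⊖ x) ^S 3 ⊗ (1S ⊖ μ ^S 2 ⊗ x ^S 5)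

  μ⊗Dμ≈[uS⊖1S]⊗P : (μ ⊗ Dμ) ≈S ((uS ⊖ 1S) ⊗ P)
  μ⊗Dμ≈[uS⊖1S]⊗P = ⊘-elim Dμ≈[]1 μ-eq
    where
    Dμ≈[]1 : Dμ ≈[ 0 ] 1S
    Dμ≈[]1 = ⊗-≈[]1 (⊗-≈[]1 (^S-≈[]1 (1S⊕-≈[]1 x≈[]0) 2) (^S-≈[]1 (1S⊖-≈[]1 x≈[]0) 3))
                    (1S⊖-≈[]1 (⊗-≈[]0ʳ (μ ^S 2) (x^suc≈[]0 4)))

  -- The μ-equation says u P = P + μ Dμ, which factors as A₀ A₃² A₄.
  uS⊗A₁A₂²A₅≈A₀A₃²A₄ : (uS ⊗ (A 1 ⊗ A 2 ^S 2 ⊗ A 5)) ≈S (A 0 ⊗ A 3 ⊗ A 3 ⊗ A 4)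
  uS⊗A₁A₂²A₅≈A₀A₃²A₄ = begin
    uS ⊗ P₁                ≈⟨ solve 2 (λ u p → u :* p := p :+ (u :- con (+ 1)) :* p) (λ _ _ → ≡.refl) uS P₁ ⟩
    P₁ ⊕ (uS ⊖ 1S) ⊗ P₁    ≈⟨ +-congˡ {P₁} (*-congˡ {uS ⊖ 1S} P₁≈P) ⟩
    P₁ ⊕ (uS ⊖ 1S) ⊗ P     ≈⟨ +-congˡ {P₁} μ⊗Dμ≈[uS⊖1S]⊗P ⟨
    P₁ ⊕ μ ⊗ Dμ            ≈⟨ solve 2 (λ x m → let B = λ k → con (+ 1) :+ m :* x :^ k in
                                 B 1 :* B 2 :^ 2 :* B 5
                                 :+ m :* ((con (+ 1) :+ x) :^ 2 :* (con (+ 1) :- x) :^ 3 :* (con (+ 1) :- m :^ 2 :* x :^ 5))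
                                 := B 0 :* B 3 :* B 3 :* B 4)
                              (λ _ _ → ≡.refl) x μ ⟩
    A 0 ⊗ A 3 ⊗ A 3 ⊗ A 4 ∎
    where
    P₁ : Series
    P₁ = A 1 ⊗ A 2 ^S 2 ⊗ A 5
    P₁≈P : P₁ ≈S P
    P₁≈P = *-congʳ {A 5} (*-congʳ {A 2 ^S 2} (+-congˡ {1S} (*-congˡ {μ} (*-identityʳ x))))

  zS⊗uS⊗closedForm³≈E : (zS ⊗ (uS ⊗ ((closedForm 1 ⊗ closedForm 0) ⊗ closedForm 1))) ≈S E 0
  zS⊗uS⊗closedForm³≈E = begin
    zS ⊗ (uS ⊗ ((closedForm 1 ⊗ closedForm 0) ⊗ closedForm 1))
      ≈⟨ rearrange 10 (λ z u t a₁ a₂ a₃ a₄ a₅ i₀ i₁ →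
           z · (u · ((t · (a₂ · a₅) · i₁ · (t · (a₁ · a₄) · i₀)) · (t · (a₂ · a₅) · i₁)))
           ≡× z · (t · (t · (t · ε))) · (u · (a₁ · (a₂ · (a₂ · ε)) · a₅)) · (a₄ · a₅ · i₀ · i₁ · i₁))
           (λ _ _ → ≡.refl) zS uS t (A 1) (A 2) (A 3) (A 4) (A 5) (I 0) (I 1) ⟩
    zS ⊗ t ^S 3 ⊗ (uS ⊗ (A 1 ⊗ A 2 ^S 2 ⊗ A 5)) ⊗ G
      ≈⟨ *-congʳ {G} (*-cong zS⊗t³≈x⊗V uS⊗A₁A₂²A₅≈A₀A₃²A₄) ⟩
    x ⊗ V ⊗ (A 0 ⊗ A 3 ⊗ A 3 ⊗ A 4) ⊗ G
      ≈⟨ rearrange 8 (λ x v a₀ a₃ a₄ a₅ i₀ i₁ →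
           x · v · (a₀ · a₃ · a₃ · a₄) · (a₄ · a₅ · i₀ · i₁ · i₁)
           ≡× x · v · (a₀ · a₅) · i₀ · ((a₃ · a₄) · i₁) · ((a₃ · a₄) · i₁))
           (λ _ _ → ≡.refl) x V (A 0) (A 3) (A 4) (A 5) (I 0) (I 1) ⟩
    E 0 ⊗ (D 1 ⊗ I 1) ⊗ (D 1 ⊗ I 1)
      ≈⟨ *-cong (*-congˡ {E 0} (D⊗I 1)) (D⊗I 1) ⟩
    E 0 ⊗ 1S ⊗ 1S
      ≈⟨ rearrange 1 (λ e → e · ε · ε ≡× e) (λ _ _ → ≡.refl) (E 0) ⟩
    E 0 ∎
    where
    G : Series
    G = A 4 ⊗ A 5 ⊗ I 0 ⊗ I 1 ⊗ I 1

  closedForm-rec-zero : closedForm 0 ≈S leafOrNode uS (closedForm 1) (closedForm 0) (closedForm 1)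
  closedForm-rec-zero = trans (closedForm≈1S⊕E 0) (+-congˡ {1S} (sym zS⊗uS⊗closedForm³≈E))

  closedForm-rec-suc : ∀ m →
    closedForm (1 + m) ≈S leafOrNode 1S (closedForm (2 + m)) (closedForm (1 + m)) (closedForm m)
  closedForm-rec-suc m = trans (closedForm≈1S⊕E (1 + m)) (+-congˡ {1S} (sym (zS⊗closedForm³≈E m)))

  -- S_j = S_(-j), so the solution of the recurrence on all of ℤ is closedForm ∣ j ∣.
  R : ℤ → Series
  R j = closedForm ℤ.∣ j ∣

  R-rec : ∀ j → R j ≈S leafOrNode (rootWeight j) (R (j ℤ.+ + 1)) (R j) (R (j ℤ.- + 1))
  R-rec (+ zero) = closedForm-rec-zero
  R-rec (+ suc m) = trans (closedForm-rec-suc m)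
    (reflexive (≡.cong (λ e → leafOrNode 1S (closedForm e) (closedForm (1 + m)) (closedForm m)) (ℕ.+-comm 1 (suc m))))
  R-rec ℤ.-[1+ m ] = trans (closedForm-rec-suc m) (trans (leafOrNode-swap (closedForm (2 + m)) (closedForm m))
    (reflexive (≡.cong₂ (λ e e′ → leafOrNode 1S (closedForm e) (closedForm (1 + m)) (closedForm e′))
                        (≡.sym (∣-[1+m]+1∣≡m m)) (≡.cong (λ e → 2 + e) (≡.sym (ℕ.+-identityʳ m))))))
    where
    ∣-[1+m]+1∣≡m : ∀ m → ℤ.∣ ℤ.-[1+ m ] ℤ.+ + 1 ∣ ≡ m
    ∣-[1+m]+1∣≡m zero = ≡.refl
    ∣-[1+m]+1∣≡m (suc m) = ≡.refl
    leafOrNode-swap : ∀ l r → leafOrNode 1S l (closedForm (1 + m)) r ≈S leafOrNode 1S r (closedForm (1 + m)) l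
    leafOrNode-swap l r = solve 4 (λ z l c r → con (+ 1) :+ z :* (con (+ 1) :* ((l :* c) :* r))
                                             := con (+ 1) :+ z :* (con (+ 1) :* ((r :* c) :* l)))
                                  (λ _ _ → ≡.refl) zS l (closedForm (1 + m)) r

import Relation.Binary.PropositionalEquality as ≡
open TreeCounting using (S≈solution)

theorem2 : (T X : ℕ → ℤ) (μ : Series)
    → T 0 ≡ + 1
    → embed T ≈S (1S ⊕ zS ⊗ embed T ^S 3)
    → X 0 ≡ + 0
    → embed X ≈S (zS ⊗ (1S ⊕ embed X ⊕ embed X ^S 2) ^S 3 ⊘ (1S ⊕ embed X ^S 2) ^S 2)
    → VanishesAtU1 μ
    → μ ≈S ((uS ⊖ 1S)
             ⊗ ((1S ⊕ μ ⊗ embed X) ⊗ (1S ⊕ μ ⊗ embed X ^S 2) ^S 2 ⊗ (1S ⊕ μ ⊗ embed X ^S 5))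
             ⊘ ((1S ⊕ embed X) ^S 2 ⊗ (1S ⊖ embed X) ^S 3 ⊗ (1S ⊖ μ ^S 2 ⊗ embed X ^S 5)))
    → (j : ℕ)
    → S (+ j) ≈S (embed T ⊗ ((1S ⊕ μ ⊗ embed X ^S (j + 1)) ⊗ (1S ⊕ μ ⊗ embed X ^S (j + 4)))
                   ⊘ ((1S ⊕ μ ⊗ embed X ^S (j + 2)) ⊗ (1S ⊕ μ ⊗ embed X ^S (j + 3))))
-- T(0) = 1 already follows from the equation of T, and the identity holds for every solution μ of
-- its equation.
theorem2 T X μ _ T-eq X0≡0 X-eq _ μ-eq j n k =
  ≡.trans (S≈solution R R-rec (+ j) n k) (≡.cong (λ F → F n k) (closedForm≡ j))
  where open ClosedForm T X μ X0≡0 T-eq X-eq μ-eq
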